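{- Let $G=(V,E)$ be a simple connected graph with $n=|V|$ vertices and diameter $d$. Then $f(G) \leq \left(n + \left\lfloor \frac{n-1}{d} \right\rfloor - 1\right) 2^{d-1} - n + 2$.
   Context: A distribution of pebbles on $G$ is a function $D: V \to \mathbb{N}$; its size is $\sum_v D(v)$. A pebbling step removes two pebbles from a vertex and places one pebble on an adjacent vertex. For a root vertex $v$, $D$ is $v$-solvable if at least one pebble can be placed on $v$ after some sequence of pebbling steps; $D$ is solvable if it is $v$-solvable for every $v\in V$. The pebbling number $f(G)$ is the smallest integer $N$ such that every distribution of size $N$ is solvable. -}

module Defs where

open import Data.Nat using (ℕ; zero; suc; _+_; _≤_; _<_)
open import Data.Fin using (Fin; _≟_)
open import Data.List using (map; allFin)
open import Data.Nat.ListAction using (sum)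
open import Data.Bool using (if_then_else_)
open import Data.Product using (Σ; _×_; ∃)
open import Relation.Nullary using (¬_)
open import Relation.Nullary.Decidable using (⌊_⌋)
open import Relation.Binary.PropositionalEquality using (_≡_)

record SimpleGraph (n : ℕ) : Set₁ where
  field
    Adj   : Fin n → Fin n → Set
    sym   : ∀ {u v} → Adj u v → Adj v u
    irrefl : ∀ {u} → ¬ Adj u u
open SimpleGraph public

data Walk {n : ℕ} (G : SimpleGraph n) : Fin n → Fin n → ℕ → Set where
  nil  : ∀ {u} → Walk G u u 0
  cons : ∀ {u w v k} → Adj G u w → Walk G w v k → Walk G u v (suc k)

Connected : {n : ℕ} → SimpleGraph n → Set
Connected {n} G = ∀ (u v : Fin n) → ∃ λ k → Walk G u v k

Dist : {n : ℕ} → SimpleGraph n → Fin n → Fin n → ℕ → Set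
Dist G u v k = Walk G u v k × (∀ j → j < k → ¬ Walk G u v j)

Diameter : {n : ℕ} → SimpleGraph n → ℕ → Set
Diameter {n} G d =
  (∀ (u v : Fin n) → Σ ℕ λ k → Dist G u v k × k ≤ d)
  × Σ (Fin n) λ u → Σ (Fin n) λ v → Dist G u v d

Distribution : ℕ → Set
Distribution n = Fin n → ℕ

size : {n : ℕ} → Distribution n → ℕ
size {n} D = sum (map D (allFin n))

open import Data.Nat using (_∸_)

move : {n : ℕ} → Distribution n → Fin n → Fin n → Distribution n
move D u v w =
  (D w ∸ (if ⌊ w ≟ u ⌋ then 2 else 0)) + (if ⌊ w ≟ v ⌋ then 1 else 0)

data Reachable {n : ℕ} (G : SimpleGraph n) : Distribution n → Distribution n → Set where
  done : ∀ {D} → Reachable G D D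
  step : ∀ {D D'} (u v : Fin n) → Adj G u v → 2 ≤ D u →
         Reachable G (move D u v) D' → Reachable G D D'

Solvable-at : {n : ℕ} → SimpleGraph n → Distribution n → Fin n → Set
Solvable-at G D r = Σ _ λ D' → Reachable G D D' × 1 ≤ D' r

Solvable : {n : ℕ} → SimpleGraph n → Distribution n → Set
Solvable {n} G D = ∀ (r : Fin n) → Solvable-at G D r

AllSolvable : {n : ℕ} → SimpleGraph n → ℕ → Set
AllSolvable {n} G N = ∀ (D : Distribution n) → size D ≡ N → Solvable G D

-- f(G) ≤ B : since f(G) is the least N with AllSolvable G N,
-- f(G) ≤ B holds iff some N ≤ B has AllSolvable G N.
PebblingNumber≤ : {n : ℕ} → SimpleGraph n → ℕ → Set
PebblingNumber≤ G B = Σ ℕ λ N → N ≤ B × AllSolvable G N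

-- Fix a root r and let h v be the distance from v to r. A vertex v holding at least 2^(h v)
-- pebbles reaches r along a shortest walk. Otherwise v can push ⌊D v/2⌋ pebbles to a
-- neighbour one step closer to r, losing ⌈D v/2⌉ ≤ ⌊2^(h v)/2⌋ =: cost v. Draining the
-- vertices from the farthest inwards thus solves r whenever D has more than Σ_v cost v
-- pebbles. As cost r = 0, some neighbour of r costs 1 and every cost is at most 2^(d-1),
-- this gives f(G) ≤ (n-2)·2^(d-1) + 2, which is at most the stated bound because
-- n ≤ (1 + ⌊(n-1)/d⌋)·d ≤ (1 + ⌊(n-1)/d⌋)·2^(d-1).

{-# OPTIONS --safe #-}
module Submission where

open import Defs hiding (sym)
open import Data.Nat
  using (ℕ; zero; suc; _+_; _*_; _∸_; _^_; _/_; _%_; NonZero; _≤_; _<_; z≤n; s≤s; z<s; ⌊_/2⌋; ⌈_/2⌉)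
  renaming (_≟_ to _≟ℕ_)
open import Data.Nat.Properties hiding (_≟_)
open import Data.Nat.DivMod using (m≡m%n+[m/n]*n; m%n<n; [m+kn]%n≡m%n; m<n⇒m%n≡m)
open import Data.Nat.ListAction using () renaming (sum to sumᴸ)
open import Data.Nat.Tactic.RingSolver using (solve-∀)
open import Data.Fin using (Fin; zero; suc; toℕ; _≟_; punchIn; punchOut)
open import Data.Fin.Properties using (toℕ-injective; toℕ<n; nonZeroIndex; punchIn-punchOut; any?)
  renaming (suc-injective to Fin-suc-injective)
open import Data.List using (tabulate)
open import Data.List.Properties using (map-tabulate)
open import Data.Vec.Functional using (Vector; removeAt)
open import Algebra.Properties.CommutativeMonoid.Sum +-0-commutativeMonoid
  using (sum; sum-cong-≗; sum-remove; sum-replicate-zero)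
open import Algebra.Properties.CommutativeSemigroup +-commutativeSemigroup using (xy∙z≈xz∙y)
open import Data.Bool using (if_then_else_)
open import Data.Product using (Σ; ∃; ∃₂; _×_; _,_; proj₁; proj₂)
open import Function using (_∘_; id)
open import Relation.Nullary using (yes; no; does; contradiction)
open import Relation.Nullary.Decidable using (dec-true; dec-false)
open import Relation.Binary using (tri<; tri≈; tri>)
open import Relation.Binary.PropositionalEquality using (_≡_; _≢_; refl; sym; trans; cong; cong₂; subst; subst₂)

open ≤-Reasoning

size≡sum : ∀ {n} (D : Distribution n) → size D ≡ sum D
size≡sum D = trans (cong sumᴸ (map-tabulate id D)) (sumᴸ-tabulate D)
  where
  sumᴸ-tabulate : ∀ {k} (f : Vector ℕ k) → sumᴸ (tabulate f) ≡ sum f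
  sumᴸ-tabulate {zero}  f = refl
  sumᴸ-tabulate {suc k} f = cong (f zero +_) (sumᴸ-tabulate (f ∘ suc))

sum-bounded : ∀ {n M} (f : Vector ℕ n) → (∀ i → f i ≤ M) → sum f ≤ n * M
sum-bounded {zero}  f f≤M = z≤n
sum-bounded {suc n} f f≤M = +-mono-≤ (f≤M zero) (sum-bounded (f ∘ suc) (f≤M ∘ suc))

sum-agree-except : ∀ {n} (f g : Vector ℕ n) v {k} →
                   (∀ w → w ≢ v → f w ≡ g w) → f v ≡ g v + k → sum f ≡ sum g + k
sum-agree-except f g zero {k} agree f0≡ = begin-equality
  f zero + sum (f ∘ suc)     ≡⟨ cong₂ _+_ f0≡ (sum-cong-≗ (λ w → agree (suc w) λ ())) ⟩
  g zero + k + sum (g ∘ suc) ≡⟨ xy∙z≈xz∙y (g zero) k _ ⟩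
  g zero + sum (g ∘ suc) + k ∎
sum-agree-except f g (suc v) {k} agree fv≡ = begin-equality
  f zero + sum (f ∘ suc)       ≡⟨ cong₂ _+_ (agree zero λ ()) tail≡ ⟩
  g zero + (sum (g ∘ suc) + k) ≡⟨ +-assoc (g zero) _ k ⟨
  g zero + sum (g ∘ suc) + k   ∎
  where
  tail≡ : sum (f ∘ suc) ≡ sum (g ∘ suc) + k
  tail≡ = sum-agree-except (f ∘ suc) (g ∘ suc) v (λ w w≢v → agree (suc w) (w≢v ∘ Fin-suc-injective)) fv≡

sum≤two+rest : ∀ {m M} (f : Vector ℕ (2 + m)) {a b} → a ≢ b → (∀ i → f i ≤ M) →
               sum f ≤ f a + f b + m * M
sum≤two+rest {m} {M} f {a} {b} a≢b f≤M = begin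
  sum f                                           ≡⟨ sum-remove {i = a} f ⟩
  f a + sum (removeAt f a)                        ≡⟨ cong (f a +_) (sum-remove {i = punchOut a≢b} (removeAt f a)) ⟩
  f a + (f (punchIn a (punchOut a≢b)) + sum rest) ≡⟨ cong (λ i → f a + (f i + sum rest)) (punchIn-punchOut a≢b) ⟩
  f a + (f b + sum rest)                          ≡⟨ +-assoc (f a) (f b) _ ⟨
  f a + f b + sum rest                            ≤⟨ +-monoʳ-≤ (f a + f b) (sum-bounded rest (λ i → f≤M _)) ⟩
  f a + f b + m * M                               ∎
  where
  rest : Vector ℕ m
  rest = removeAt (removeAt f a) (punchOut a≢b)

2*⌊n/2⌋≤n : ∀ n → 2 * ⌊ n /2⌋ ≤ n
2*⌊n/2⌋≤n n = begin
  2 * ⌊ n /2⌋       ≡⟨ cong (⌊ n /2⌋ +_) (+-identityʳ _) ⟩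
  ⌊ n /2⌋ + ⌊ n /2⌋ ≤⟨ +-monoʳ-≤ ⌊ n /2⌋ (⌊n/2⌋≤⌈n/2⌉ n) ⟩
  ⌊ n /2⌋ + ⌈ n /2⌉ ≡⟨ ⌊n/2⌋+⌈n/2⌉≡n n ⟩
  n                 ∎

⌊2^[1+n]/2⌋≡2^n : ∀ n → ⌊ 2 ^ suc n /2⌋ ≡ 2 ^ n
⌊2^[1+n]/2⌋≡2^n n = trans (cong (λ x → ⌊ 2 ^ n + x /2⌋) (+-identityʳ (2 ^ n))) (sym (n≡⌊n+n/2⌋ (2 ^ n)))

n<2^n : ∀ n → n < 2 ^ n
n<2^n zero    = z<s
n<2^n (suc n) = begin-strict
  suc n         <⟨ +-mono-≤ (m^n>0 2 n) (n<2^n n) ⟩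
  2 ^ n + 2 ^ n ≡⟨ cong (2 ^ n +_) (+-identityʳ (2 ^ n)) ⟨
  2 ^ suc n     ∎

cancel-loss-≤ : ∀ a b {x y z} → a + x ≤ b + (y + z) → z ≤ x → a ≤ b + y
cancel-loss-≤ a b {x} {y} {z} le z≤x = +-cancelʳ-≤ x a (b + y) (begin
  a + x       ≤⟨ le ⟩
  b + (y + z) ≤⟨ +-monoʳ-≤ b (+-monoʳ-≤ y z≤x) ⟩
  b + (y + x) ≡⟨ +-assoc b y x ⟨
  b + y + x   ∎)

module Paths {n} (G : SimpleGraph n) where

  Adj⇒≢ : ∀ {u v} → Adj G u v → u ≢ v
  Adj⇒≢ u~u refl = irrefl G u~u

  Dist-suc⇒≢ : ∀ {u v k} → Dist G u v (suc k) → u ≢ v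
  Dist-suc⇒≢ (_ , no-shorter) refl = no-shorter 0 z<s nil

  Dist-minimal : ∀ {u v k j} → Dist G u v k → Walk G u v j → k ≤ j
  Dist-minimal (_ , no-shorter) W = ≮⇒≥ (λ j<k → no-shorter _ j<k W)

  walk-first-step : ∀ {u v k} → Walk G u v k → u ≢ v →
                    ∃₂ λ p j → Adj G u p × Walk G p v j × k ≡ suc j
  walk-first-step nil          u≢u = contradiction refl u≢u
  walk-first-step (cons u~p W) _   = _ , _ , u~p , W , refl

module Pebbling {n} (G : SimpleGraph n) where

  open Paths G

  Reachable-trans : ∀ {A B C} → Reachable G A B → Reachable G B C → Reachable G A C
  Reachable-trans done                 B↝C = B↝C
  Reachable-trans (step u v u~v 2≤ A↝B) B↝C = step u v u~v 2≤ (Reachable-trans A↝B B↝C)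

  Reachable⇒Solvable-at : ∀ {D D' r} → Reachable G D D' → Solvable-at G D' r → Solvable-at G D r
  Reachable⇒Solvable-at D↝D' (E , D'↝E , 1≤Er) = E , Reachable-trans D↝D' D'↝E , 1≤Er

  move-source : ∀ (D : Distribution n) {u v} → u ≢ v → move D u v u ≡ D u ∸ 2
  move-source D {u} {v} u≢v with u ≟ u | u ≟ v
  ... | yes _   | no _    = +-identityʳ _
  ... | no u≢u  | _       = contradiction refl u≢u
  ... | _       | yes u≡v = contradiction u≡v u≢v

  move-target : ∀ (D : Distribution n) {u v} → u ≢ v → move D u v v ≡ D v + 1
  move-target D {u} {v} u≢v with v ≟ u | v ≟ v
  ... | no _    | yes _  = refl
  ... | yes v≡u | _      = contradiction (sym v≡u) u≢v
  ... | _       | no v≢v = contradiction refl v≢v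

  move-other : ∀ (D : Distribution n) {u v w} → w ≢ u → w ≢ v → move D u v w ≡ D w
  move-other D {u} {v} {w} w≢u w≢v with w ≟ u | w ≟ v
  ... | no _    | no _    = +-identityʳ _
  ... | yes w≡u | _       = contradiction w≡u w≢u
  ... | _       | yes w≡v = contradiction w≡v w≢v

  moves : ℕ → Distribution n → Fin n → Fin n → Distribution n
  moves zero    D u v = D
  moves (suc k) D u v = moves k (move D u v) u v

  moves-reachable : ∀ k (D : Distribution n) {u v} → Adj G u v → 2 * k ≤ D u → Reachable G D (moves k D u v)
  moves-reachable zero    D u~v _  = done
  moves-reachable (suc k) D {u} {v} u~v le =
    step u v u~v (m+n≤o⇒m≤o 2 le′) (moves-reachable k (move D u v) u~v
      (subst (2 * k ≤_) (sym (move-source D (Adj⇒≢ u~v)))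
        (m+n≤o⇒m≤o∸n (2 * k) (subst (_≤ D u) (+-comm 2 (2 * k)) le′))))
    where le′ : 2 + 2 * k ≤ D u
          le′ = subst (_≤ D u) (*-suc 2 k) le

  moves-target : ∀ k (D : Distribution n) {u v} → u ≢ v → moves k D u v v ≡ D v + k
  moves-target zero    D {v = v} _ = sym (+-identityʳ (D v))
  moves-target (suc k) D {u} {v} u≢v = begin-equality
    moves k (move D u v) u v v ≡⟨ moves-target k (move D u v) u≢v ⟩
    move D u v v + k           ≡⟨ cong (_+ k) (move-target D u≢v) ⟩
    D v + 1 + k                ≡⟨ +-assoc (D v) 1 k ⟩
    D v + suc k                ∎

  moves-other : ∀ k (D : Distribution n) {u v w} → w ≢ u → w ≢ v → moves k D u v w ≡ D w
  moves-other zero    D _   _   = refl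
  moves-other (suc k) D {u} {v} w≢u w≢v =
    trans (moves-other k (move D u v) w≢u w≢v) (move-other D w≢u w≢v)

  walk-solvable : ∀ {v r h} → Walk G v r h → ∀ (D : Distribution n) → 2 ^ h ≤ D v → Solvable-at G D r
  walk-solvable nil D 1≤Dr = D , done , 1≤Dr
  walk-solvable {v} {h = suc h} (cons {w = w} v~w W) D enough =
    Reachable⇒Solvable-at (moves-reachable (2 ^ h) D v~w enough)
      (walk-solvable W (moves (2 ^ h) D v w)
        (≤-trans (m≤n+m (2 ^ h) (D w)) (≤-reflexive (sym (moves-target (2 ^ h) D (Adj⇒≢ v~w))))))

module Rooted {n} (G : SimpleGraph n) (r : Fin n) (h : Fin n → ℕ) (h-root : h r ≡ 0)
  (walk : ∀ v → Walk G v r (h v))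
  (parent : ∀ v → v ≢ r → ∃ λ p → Adj G v p × h p < h v) where

  open Paths G using (Adj⇒≢)
  open Pebbling G

  cost : Fin n → ℕ
  cost v = ⌊ 2 ^ h v /2⌋

  -- Vertices are drained in decreasing order of key, i.e. by height with ties broken by
  -- index, so that a vertex is drained before the parent it pushes its pebbles to.
  key : Fin n → ℕ
  key v = toℕ v + h v * n

  key-injective : ∀ {v w} → key v ≡ key w → v ≡ w
  key-injective {v} {w} eq = toℕ-injective (begin-equality
    toℕ v      ≡⟨ m<n⇒m%n≡m (toℕ<n v) ⟨
    toℕ v % n  ≡⟨ [m+kn]%n≡m%n (toℕ v) (h v) n ⟨
    key v % n  ≡⟨ cong (_% n) eq ⟩
    key w % n  ≡⟨ [m+kn]%n≡m%n (toℕ w) (h w) n ⟩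
    toℕ w % n  ≡⟨ m<n⇒m%n≡m (toℕ<n w) ⟩
    toℕ w      ∎)
    where instance
      n≢0 : NonZero n
      n≢0 = nonZeroIndex v

  key<suc*n : ∀ {v k} → h v ≤ k → key v < suc k * n
  key<suc*n {v} hv≤k = +-mono-<-≤ (toℕ<n v) (*-monoˡ-≤ n hv≤k)

  key-mono : ∀ {v w} → h v < h w → key v < key w
  key-mono {v} {w} hv<hw = <-≤-trans (key<suc*n ≤-refl) (≤-trans (*-monoˡ-≤ n hv<hw) (m≤n+m (h w * n) (toℕ w)))

  below : ℕ → Vector ℕ n → Vector ℕ n
  below t f w = if does (key w <? t) then f w else 0

  below-< : ∀ {t} f {w} → key w < t → below t f w ≡ f w
  below-< {t} f {w} lt rewrite dec-true (key w <? t) lt = refl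

  below-≥ : ∀ {t} f {w} → t ≤ key w → below t f w ≡ 0
  below-≥ {t} f {w} ge rewrite dec-false (key w <? t) (≤⇒≯ ge) = refl

  below-cong : ∀ t {f g} w → f w ≡ g w → below t f w ≡ below t g w
  below-cong t w = cong (λ x → if does (key w <? t) then x else 0)

  below-suc : ∀ {t} f {w} → key w ≢ t → below (suc t) f w ≡ below t f w
  below-suc {t} f {w} key≢t with <-cmp (key w) t
  ... | tri< lt _ _ = trans (below-< f (m<n⇒m<1+n lt)) (sym (below-< f lt))
  ... | tri≈ _ eq _ = contradiction eq key≢t
  ... | tri> _ _ gt = trans (below-≥ f gt) (sym (below-≥ f (<⇒≤ gt)))

  sum-below-zero : ∀ f → sum (below 0 f) ≡ 0
  sum-below-zero f = trans (sum-cong-≗ {x = below 0 f} (λ w → below-≥ f {w} z≤n)) (sum-replicate-zero n)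

  sum-below-unused : ∀ {t} f → (∀ w → key w ≢ t) → sum (below (suc t) f) ≡ sum (below t f)
  sum-below-unused f unused = sum-cong-≗ (λ w → below-suc f (unused w))

  sum-below-suc : ∀ f v → sum (below (suc (key v)) f) ≡ sum (below (key v) f) + f v
  sum-below-suc f v = sum-agree-except _ _ v
    (λ w w≢v → below-suc f (w≢v ∘ key-injective))
    (trans (below-< f (n<1+n (key v))) (cong (_+ f v) (sym (below-≥ f ≤-refl))))

  sum-below-all : ∀ {k} → (∀ v → h v ≤ k) → ∀ f → sum (below (suc k * n) f) ≡ sum f
  sum-below-all h≤k f = sum-cong-≗ (λ w → below-< f (key<suc*n (h≤k w)))

  drain : ∀ (D : Distribution n) {t} v → key v ≡ t → D v < 2 ^ h v →
          ∃ λ D′ → Reachable G D D′ × sum (below t D) + ⌊ D v /2⌋ ≤ sum (below t D′)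
  drain D v refl short with v ≟ r
  ... | yes refl = D , done , ≤-reflexive (trans (cong (λ x → sum (below (key r) D) + ⌊ x /2⌋) Dr≡0) (+-identityʳ _))
    where Dr≡0 : D r ≡ 0
          Dr≡0 = n<1⇒n≡0 (subst (λ k → D r < 2 ^ k) h-root short)
  ... | no v≢r with parent v v≢r
  ... | p , v~p , hp<hv = D′ , moves-reachable k D v~p (2*⌊n/2⌋≤n (D v)) , ≤-reflexive (sym gain)
    where
    k : ℕ
    k = ⌊ D v /2⌋

    D′ : Distribution n
    D′ = moves k D v p

    unchanged : ∀ w → w ≢ p → below (key v) D′ w ≡ below (key v) D w
    unchanged w w≢p with w ≟ v
    ... | yes refl = trans (below-≥ D′ ≤-refl) (sym (below-≥ D ≤-refl))
    ... | no w≢v   = below-cong (key v) {D′} {D} w (moves-other k D w≢v w≢p)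

    gain : sum (below (key v) D′) ≡ sum (below (key v) D) + k
    gain = sum-agree-except _ _ p unchanged (begin-equality
      below (key v) D′ p ≡⟨ below-< D′ (key-mono hp<hv) ⟩
      D′ p               ≡⟨ moves-target k D (Adj⇒≢ v~p) ⟩
      D p + k            ≡⟨ cong (_+ k) (below-< D (key-mono hp<hv)) ⟨
      below (key v) D p + k ∎)

  budget-after-drain : ∀ (D : Distribution n) {t} v → key v ≡ t → D v < 2 ^ h v →
    1 + sum (below (suc t) cost) ≤ sum (below (suc t) D) →
    1 + sum (below t cost) ≤ sum (below t D) + ⌊ D v /2⌋
  budget-after-drain D v refl short enough = cancel-loss-≤ (1 + sum (below (key v) cost)) (sum (below (key v) D))
    (subst₂ _≤_ (cong suc (sum-below-suc cost v))
      (trans (sum-below-suc D v) (cong (sum (below (key v) D) +_) (sym (⌊n/2⌋+⌈n/2⌉≡n (D v)))))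
      enough)
    (⌊n/2⌋-mono short)

  solvable-below : ∀ t (D : Distribution n) → 1 + sum (below t cost) ≤ sum (below t D) → Solvable-at G D r
  solvable-below zero D enough = contradiction (≤-trans enough (≤-reflexive (sum-below-zero D))) λ ()
  solvable-below (suc t) D enough with any? (λ w → key w ≟ℕ t)
  ... | no unused = solvable-below t D
          (subst₂ (λ c d → 1 + c ≤ d) (sum-below-unused cost unused′) (sum-below-unused D unused′) enough)
    where
    unused′ : ∀ w → key w ≢ t
    unused′ w eq = unused (w , eq)
  ... | yes (v , kv) with 2 ^ h v ≤? D v
  ...   | yes reaches = walk-solvable (walk v) D reaches
  ...   | no short with drain D v kv (≰⇒> short)
  ...     | D′ , D↝D′ , gain = Reachable⇒Solvable-at D↝D′
              (solvable-below t D′ (≤-trans (budget-after-drain D v kv (≰⇒> short) enough) gain))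

  solvable-at-root : ∀ {k} → (∀ v → h v ≤ k) → ∀ (D : Distribution n) → 1 + sum cost ≤ sum D → Solvable-at G D r
  solvable-at-root {k} h≤k D enough = solvable-below (suc k * n) D
    (subst₂ (λ c d → 1 + c ≤ d) (sym (sum-below-all h≤k cost)) (sym (sum-below-all h≤k D)) enough)

module Distances {n} {G : SimpleGraph n} {d} (dist : ∀ u v → Σ ℕ λ k → Dist G u v k × k ≤ d) (r : Fin n) where

  open Paths G

  height : Fin n → ℕ
  height v = proj₁ (dist v r)

  height-Dist : ∀ v → Dist G v r (height v)
  height-Dist v = proj₁ (proj₂ (dist v r))

  height≤d : ∀ v → height v ≤ d
  height≤d v = proj₂ (proj₂ (dist v r))

  height-minimal : ∀ {v j} → Walk G v r j → height v ≤ j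
  height-minimal = Dist-minimal (height-Dist _)

  height-root : height r ≡ 0
  height-root = n≤0⇒n≡0 (height-minimal nil)

  parent : ∀ v → v ≢ r → ∃ λ p → Adj G v p × height p < height v
  parent v v≢r with walk-first-step (proj₁ (height-Dist v)) v≢r
  ... | p , j , v~p , W , hv≡1+j = p , v~p , subst (height p <_) (sym hv≡1+j) (s≤s (height-minimal W))

  open Rooted G r height height-root (proj₁ ∘ height-Dist) parent public

  cost-root : cost r ≡ 0
  cost-root = cong (λ k → ⌊ 2 ^ k /2⌋) height-root

  cost-neighbour : ∀ {u} → Adj G r u → cost u ≤ 1
  cost-neighbour r~u = ⌊n/2⌋-mono (^-monoʳ-≤ 2 (height-minimal (cons (SimpleGraph.sym G r~u) nil)))

  cost≤ : ∀ v → cost v ≤ ⌊ 2 ^ d /2⌋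
  cost≤ v = ⌊n/2⌋-mono (^-monoʳ-≤ 2 (height≤d v))

  root-neighbour : ∀ {x} → r ≢ x → ∃ λ u → Adj G r u
  root-neighbour {x} r≢x with walk-first-step (proj₁ (proj₁ (proj₂ (dist r x)))) r≢x
  ... | u , _ , r~u , _ = u , r~u

pebbling-number≤ : ∀ {m e} (G : SimpleGraph (2 + m)) → Diameter G (suc e) →
                   PebblingNumber≤ G (2 + m * 2 ^ e)
pebbling-number≤ {m} {e} G (dist , a , b , dist-ab) = 2 + m * 2 ^ e , ≤-refl , solvable
  where
  open Paths G

  solvable : AllSolvable G (2 + m * 2 ^ e)
  solvable D size≡ r = solvable-at-root height≤d D (begin
    1 + sum cost                                 ≤⟨ s≤s (sum≤two+rest cost (Adj⇒≢ r~u) cost≤) ⟩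
    1 + (cost r + cost u + m * ⌊ 2 ^ suc e /2⌋) ≡⟨ cong₂ (λ c M → 1 + (c + cost u + m * M)) cost-root (⌊2^[1+n]/2⌋≡2^n e) ⟩
    1 + (cost u + m * 2 ^ e)                     ≤⟨ s≤s (+-monoˡ-≤ (m * 2 ^ e) (cost-neighbour r~u)) ⟩
    2 + m * 2 ^ e                                ≡⟨ size≡ ⟨
    size D                                       ≡⟨ size≡sum D ⟩
    sum D                                        ∎)
    where
    open Distances dist r

    other : ∃ λ x → r ≢ x
    other with a ≟ r
    ... | yes refl = b , Dist-suc⇒≢ dist-ab
    ... | no a≢r   = a , a≢r ∘ sym

    u : Fin (2 + m)
    u = proj₁ (root-neighbour (proj₂ other))

    r~u : Adj G r u
    r~u = proj₂ (root-neighbour (proj₂ other))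

≤-paper-bound : ∀ m e → 2 + m * 2 ^ e ≤ ((2 + m + (1 + m) / suc e ∸ 1) * 2 ^ e + 2) ∸ (2 + m)
≤-paper-bound m e = m+n≤o⇒m≤o∸n (2 + m * 2 ^ e) (begin
  2 + m * 2 ^ e + (2 + m)         ≤⟨ +-monoʳ-≤ (2 + m * 2 ^ e) n≤[1+q]*2^e ⟩
  2 + m * 2 ^ e + (1 + q) * 2 ^ e ≡⟨ rearrange m q (2 ^ e) ⟩
  suc (m + q) * 2 ^ e + 2         ∎)
  where
  q : ℕ
  q = (1 + m) / suc e

  n≤[1+q]*d : 1 + m < (1 + q) * suc e
  n≤[1+q]*d = begin-strict
    1 + m                       ≡⟨ m≡m%n+[m/n]*n (1 + m) (suc e) ⟩
    (1 + m) % suc e + q * suc e <⟨ +-monoˡ-< (q * suc e) (m%n<n (1 + m) (suc e)) ⟩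
    suc e + q * suc e           ∎

  n≤[1+q]*2^e : 2 + m ≤ (1 + q) * 2 ^ e
  n≤[1+q]*2^e = ≤-trans n≤[1+q]*d (*-monoʳ-≤ (1 + q) (n<2^n e))

  rearrange : ∀ m q M → 2 + m * M + (1 + q) * M ≡ suc (m + q) * M + 2
  rearrange = solve-∀

PebblingNumber≤-mono : ∀ {n} {G : SimpleGraph n} {B B′} → B ≤ B′ → PebblingNumber≤ G B → PebblingNumber≤ G B′
PebblingNumber≤-mono B≤B′ (N , N≤B , solvable) = N , ≤-trans N≤B B≤B′ , solvable

theorem2 : (n : ℕ) (G : SimpleGraph n) (d : ℕ) .{{_ : NonZero d}} →
    Connected G → Diameter G d →
    PebblingNumber≤ G (((n + (n ∸ 1) / d ∸ 1) * 2 ^ (d ∸ 1) + 2) ∸ n)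
theorem2 zero          _ _       _ (_ , () , _)
theorem2 (suc zero)    G (suc _) _ (_ , zero , zero , dist-00) = contradiction refl (Paths.Dist-suc⇒≢ G dist-00)
theorem2 (suc (suc m)) G (suc e) _ diameter =
  PebblingNumber≤-mono (≤-paper-bound m e) (pebbling-number≤ G diameter)
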